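{- Let $G=(V,E)$ be a connected undirected graph and let $v\in V$. Let $R_1\subseteq V$ be a minimum resolving set for $G$, let $R_2\subseteq V$ be a minimum $v$-resolving set for $G$, and let $R_3\subseteq V$ be a minimum non-gate-$v$-resolving set for $G$. Then $|R_2|\le |R_1|+1$ and $|R_3|\le |R_2|+1$.
   Context: For $u,w\in V$, $d_G(u,w)$ denotes the length of a shortest $u$–$w$ path in $G$. A set $R\subseteq V$ is a resolving set for $G$ if for every two distinct $u,v\in V$ there is $w\in R$ with $d_G(u,w)\ne d_G(v,w)$; it is a minimum resolving set if no resolving set has smaller cardinality. For $A\subseteq V$, a vertex $v\in V$ is an $A$-gate of $G$ if there is a vertex $u\in V\setminus\{v\}$ such that $d_G(u,w)=d_G(u,v)+d_G(v,w)$ for all $w\in A$. A $v$-resolving set for $G$ is a resolving set $R$ for $G$ with $v\in R$; a minimum $v$-resolving set is a $v$-resolving set of minimum cardinality among all $v$-resolving sets. A non-gate-$v$-resolving set for $G$ is a $v$-resolving set $R$ such that $v$ is not an $R$-gate of $G$; a minimum non-gate-$v$-resolving set is one of minimum cardinality among all non-gate-$v$-resolving sets. -}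

module Defs where

open import Data.Nat using (ℕ; zero; suc; _+_; _≤_)
open import Data.Fin using (Fin)
open import Data.Fin.Subset using (Subset; _∈_; ∣_∣)
open import Data.Product using (Σ; _×_; ∃)
open import Relation.Binary.PropositionalEquality using (_≡_; _≢_)
open import Relation.Nullary using (¬_)

record Graph (n : ℕ) : Set₁ where
  field
    E     : Fin n → Fin n → Set
    sym   : ∀ {u w} → E u w → E w u
    irrefl : ∀ {u} → ¬ E u u

module _ {n : ℕ} (G : Graph n) where
  open Graph G

  data Walk : Fin n → Fin n → ℕ → Set where
    here : ∀ {u} → Walk u u zero
    step : ∀ {u x w k} → E u x → Walk x w k → Walk u w (suc k)

  Connected : Set
  Connected = ∀ u w → ∃ λ k → Walk u w k

  IsDistance : (Fin n → Fin n → ℕ) → Set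
  IsDistance d = ∀ u w → Walk u w (d u w) × (∀ k → Walk u w k → d u w ≤ k)

module _ {n : ℕ} (d : Fin n → Fin n → ℕ) where

  Resolving : Subset n → Set
  Resolving R = ∀ u v → u ≢ v → Σ (Fin n) λ w → w ∈ R × d u w ≢ d v w

  MinimumResolving : Subset n → Set
  MinimumResolving R = Resolving R × (∀ S → Resolving S → ∣ R ∣ ≤ ∣ S ∣)

  IsGate : Subset n → Fin n → Set
  IsGate A v = Σ (Fin n) λ u → u ≢ v × (∀ w → w ∈ A → d u w ≡ d u v + d v w)

  VResolving : Fin n → Subset n → Set
  VResolving v R = Resolving R × v ∈ R

  MinimumVResolving : Fin n → Subset n → Set
  MinimumVResolving v R = VResolving v R × (∀ S → VResolving v S → ∣ R ∣ ≤ ∣ S ∣)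

  NonGateVResolving : Fin n → Subset n → Set
  NonGateVResolving v R = VResolving v R × ¬ IsGate R v

  MinimumNonGateVResolving : Fin n → Subset n → Set
  MinimumNonGateVResolving v R =
    NonGateVResolving v R × (∀ S → NonGateVResolving v S → ∣ R ∣ ≤ ∣ S ∣)

-- R₁ ∪ {v} is a v-resolving set, and R₂ is itself non-gate unless some u ≢ v routes every
-- shortest path to R₂ through v, in which case R₂ ∪ {u} is non-gate. Indeed, a second such
-- witness u′ for R₂ ∪ {u} also routes R₂ through v; walking from the farther of u, u′ towards v
-- until the distance to v matches the nearer one reaches a vertex with the nearer one's
-- distances to R₂, hence (R₂ resolving) the nearer one itself. So one witness lies on a
-- geodesic from the other to v, contradicting d(u′, u) = d(u′, v) + d(v, u) with u, u′ ≢ v.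
module Submission where

open import Defs
open import Data.Nat using (ℕ; zero; suc; _+_; _∸_; _≤_; _<_; _≤?_; z≤n; s≤s)
open import Data.Nat.Properties
  using ( ≤-trans; ≤-reflexive; ≤-antisym; ≤-total; <⇒≱; module ≤-Reasoning
        ; +-suc; +-assoc; +-monoʳ-≤; +-monoˡ-≤; +-cancelˡ-≤; n≤1+n; m≤m+n; m+n≤o⇒m≤o
        ; m<m+n; m<n+m; m∸n+n≡m )
open import Data.Fin using (Fin; _≟_)
open import Data.Fin.Subset using (Subset; ∣_∣; _∪_; ⁅_⁆; _∈_; _⊆_; inside; outside)
open import Data.Fin.Subset.Properties using (x∈p∪q⁺; x∈⁅x⁆; ∣⁅x⁆∣≡1; p⊆p∪q)
open import Data.Product using (_×_; ∃; _,_; proj₁; proj₂)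
open import Data.Sum using (inj₁; inj₂; [_,_])
open import Data.Empty using (⊥)
open import Data.Vec using ([]; _∷_)
open import Relation.Nullary using (¬_; yes; no; contradiction)
open import Relation.Nullary.Decidable using (decidable-stable)
open import Relation.Binary.PropositionalEquality
  using (_≡_; _≢_; ≢-sym; refl; sym; trans; cong; subst; subst₂)

∣p∪q∣≤∣p∣+∣q∣ : ∀ {m} (p q : Subset m) → ∣ p ∪ q ∣ ≤ ∣ p ∣ + ∣ q ∣
∣p∪q∣≤∣p∣+∣q∣ []            []            = z≤n
∣p∪q∣≤∣p∣+∣q∣ (outside ∷ p) (outside ∷ q) = ∣p∪q∣≤∣p∣+∣q∣ p q
∣p∪q∣≤∣p∣+∣q∣ (outside ∷ p) (inside ∷ q)  =
  ≤-trans (s≤s (∣p∪q∣≤∣p∣+∣q∣ p q)) (≤-reflexive (sym (+-suc ∣ p ∣ ∣ q ∣)))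
∣p∪q∣≤∣p∣+∣q∣ (inside ∷ p)  (outside ∷ q) = s≤s (∣p∪q∣≤∣p∣+∣q∣ p q)
∣p∪q∣≤∣p∣+∣q∣ (inside ∷ p)  (inside ∷ q)  =
  s≤s (≤-trans (∣p∪q∣≤∣p∣+∣q∣ p q) (+-monoʳ-≤ ∣ p ∣ (n≤1+n ∣ q ∣)))

∣p∪⁅x⁆∣≤∣p∣+1 : ∀ {m} (p : Subset m) x → ∣ p ∪ ⁅ x ⁆ ∣ ≤ ∣ p ∣ + 1
∣p∪⁅x⁆∣≤∣p∣+1 p x =
  ≤-trans (∣p∪q∣≤∣p∣+∣q∣ p ⁅ x ⁆) (≤-reflexive (cong (∣ p ∣ +_) (∣⁅x⁆∣≡1 x)))

module _ {n : ℕ} (d : Fin n → Fin n → ℕ) where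

  Resolving-mono : ∀ {R S} → R ⊆ S → Resolving d R → Resolving d S
  Resolving-mono R⊆S resolves u v u≢v with resolves u v u≢v
  ... | w , w∈R , separates = w , R⊆S w∈R , separates

  Resolving-∪⁅x⁆ : ∀ {R} x → Resolving d R → Resolving d (R ∪ ⁅ x ⁆)
  Resolving-∪⁅x⁆ x = Resolving-mono (p⊆p∪q ⁅ x ⁆)

  resolved-≡ : ∀ {R} → Resolving d R → ∀ {u z} → (∀ w → w ∈ R → d z w ≡ d u w) → z ≡ u
  resolved-≡ resolves {u} {z} agree with z ≟ u
  ... | yes z≡u = z≡u
  ... | no z≢u with resolves z u z≢u
  ...   | w , w∈R , separates = contradiction (agree w w∈R) separates

  -- Every shortest path from u to R passes through v; IsGate d R v unfolds to a witness
  -- u ≢ v of ThroughGate d R v u.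
  ThroughGate : Subset n → Fin n → Fin n → Set
  ThroughGate R v u = ∀ w → w ∈ R → d u w ≡ d u v + d v w

module Walks {n : ℕ} (G : Graph n) where
  open Graph G using (E)

  _++_ : ∀ {u x w k m} → Walk G u x k → Walk G x w m → Walk G u w (k + m)
  here     ++ q = q
  step e p ++ q = step e (p ++ q)

  _∷ʳ_ : ∀ {u x w k} → Walk G u x k → E x w → Walk G u w (suc k)
  here     ∷ʳ e = step e here
  step f p ∷ʳ e = step f (p ∷ʳ e)

  reverse : ∀ {u w k} → Walk G u w k → Walk G w u k
  reverse here       = here
  reverse (step e p) = reverse p ∷ʳ Graph.sym G e

  splitAt : ∀ {u w} m {k} → Walk G u w (m + k) → ∃ λ z → Walk G u z m × Walk G z w k
  splitAt zero    p          = _ , here , p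
  splitAt (suc m) (step e p) with splitAt m p
  ... | z , p₁ , p₂ = z , step e p₁ , p₂

  Walk-length0⇒≡ : ∀ {u w} → Walk G u w 0 → u ≡ w
  Walk-length0⇒≡ here = refl

module Distance {n : ℕ} (G : Graph n) (d : Fin n → Fin n → ℕ) (isDistance : IsDistance G d) where
  open Walks G

  geodesic : ∀ u w → Walk G u w (d u w)
  geodesic u w = proj₁ (isDistance u w)

  d≤length : ∀ {u w k} → Walk G u w k → d u w ≤ k
  d≤length {u} {w} {k} = proj₂ (isDistance u w) k

  d-triangle : ∀ x y z → d x z ≤ d x y + d y z
  d-triangle x y z = d≤length (geodesic x y ++ geodesic y z)

  d-sym : ∀ u w → d u w ≡ d w u
  d-sym u w = ≤-antisym (d≤length (reverse (geodesic w u))) (d≤length (reverse (geodesic u w)))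

  d>0 : ∀ {u w} → u ≢ w → 0 < d u w
  d>0 {u} {w} u≢w with d u w in eq
  ... | zero  = contradiction (Walk-length0⇒≡ (subst (Walk G u w) eq (geodesic u w))) u≢w
  ... | suc _ = s≤s z≤n

  ThroughGate-between : ∀ {R v x y} → Resolving d R →
                        ThroughGate d R v x → ThroughGate d R v y →
                        d x v ≤ d y v → d y x + d x v ≤ d y v
  ThroughGate-between {R} {v} {x} {y} resolves x-gated y-gated dxv≤dyv =
    subst (λ t → d y t + d x v ≤ d y v) z≡x
      (≤-trans (+-monoˡ-≤ (d x v) (d≤length y⇝z)) (≤-reflexive c+dxv≡dyv))
    where
    c = d y v ∸ d x v
    c+dxv≡dyv : c + d x v ≡ d y v
    c+dxv≡dyv = m∸n+n≡m dxv≤dyv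
    split = splitAt c (subst (Walk G y v) (sym c+dxv≡dyv) (geodesic y v))
    z = proj₁ split
    y⇝z = proj₁ (proj₂ split)
    z⇝v = proj₂ (proj₂ split)
    dz≤dx : ∀ w → w ∈ R → d z w ≤ d x w
    dz≤dx w w∈R = begin
      d z w           ≤⟨ d-triangle z v w ⟩
      d z v + d v w   ≤⟨ +-monoˡ-≤ (d v w) (d≤length z⇝v) ⟩
      d x v + d v w   ≡⟨ sym (x-gated w w∈R) ⟩
      d x w           ∎
      where open ≤-Reasoning
    dx≤dz : ∀ w → w ∈ R → d x w ≤ d z w
    dx≤dz w w∈R = +-cancelˡ-≤ c (d x w) (d z w) (begin
      c + d x w             ≡⟨ cong (c +_) (x-gated w w∈R) ⟩
      c + (d x v + d v w)   ≡⟨ sym (+-assoc c (d x v) (d v w)) ⟩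
      c + d x v + d v w     ≡⟨ cong (_+ d v w) c+dxv≡dyv ⟩
      d y v + d v w         ≡⟨ sym (y-gated w w∈R) ⟩
      d y w                 ≤⟨ d-triangle y z w ⟩
      d y z + d z w         ≤⟨ +-monoˡ-≤ (d z w) (d≤length y⇝z) ⟩
      c + d z w             ∎)
      where open ≤-Reasoning
    z≡x : z ≡ x
    z≡x = resolved-≡ d resolves (λ w w∈R → ≤-antisym (dz≤dx w w∈R) (dx≤dz w w∈R))

  ¬IsGate-∪-witness : ∀ {R v u} → Resolving d R → u ≢ v → ThroughGate d R v u →
                      ¬ IsGate d (R ∪ ⁅ u ⁆) v
  ¬IsGate-∪-witness {R} {v} {u} resolves u≢v u-gated (u′ , u′≢v , u′-gated) =
    [ u-nearer , u′-nearer ] (≤-total (d u v) (d u′ v))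
    where
    u′-gated-R : ThroughGate d R v u′
    u′-gated-R w w∈R = u′-gated w (x∈p∪q⁺ (inj₁ w∈R))

    du′u≡du′v+dvu : d u′ u ≡ d u′ v + d v u
    du′u≡du′v+dvu = u′-gated u (x∈p∪q⁺ (inj₂ (x∈⁅x⁆ u)))

    u-nearer : d u v ≤ d u′ v → ⊥
    u-nearer duv≤du′v = <⇒≱ du′v<du′u
      (m+n≤o⇒m≤o (d u′ u) (ThroughGate-between resolves u-gated u′-gated-R duv≤du′v))
      where
      du′v<du′u : d u′ v < d u′ u
      du′v<du′u = subst (d u′ v <_) (sym du′u≡du′v+dvu) (m<m+n (d u′ v) (d>0 (≢-sym u≢v)))

    u′-nearer : d u′ v ≤ d u v → ⊥
    u′-nearer du′v≤duv = <⇒≱ duv<duu′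
      (m+n≤o⇒m≤o (d u u′) (ThroughGate-between resolves u′-gated-R u-gated du′v≤duv))
      where
      duv<duu′ : d u v < d u u′
      duv<duu′ = subst₂ _<_ (d-sym v u) (trans (sym du′u≡du′v+dvu) (d-sym u′ u))
                   (m<n+m (d v u) (d>0 u′≢v))

lemma1 : {n : ℕ} (G : Graph n) → Connected G →
    (d : Fin n → Fin n → ℕ) → IsDistance G d →
    (v : Fin n) (R₁ R₂ R₃ : Subset n) →
    MinimumResolving d R₁ →
    MinimumVResolving d v R₂ →
    MinimumNonGateVResolving d v R₃ →
    (∣ R₂ ∣ ≤ ∣ R₁ ∣ + 1) × (∣ R₃ ∣ ≤ ∣ R₂ ∣ + 1)
lemma1 G _ d isDistance v R₁ R₂ R₃
       (resolves₁ , _) (v-resolves₂@(resolves₂ , v∈R₂) , minimal₂) (_ , minimal₃) =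
  R₂-bound , decidable-stable (∣ R₃ ∣ ≤? ∣ R₂ ∣ + 1) ¬¬R₃-bound
  where
  open Distance G d isDistance

  R₂-bound : ∣ R₂ ∣ ≤ ∣ R₁ ∣ + 1
  R₂-bound = ≤-trans
    (minimal₂ (R₁ ∪ ⁅ v ⁆) (Resolving-∪⁅x⁆ d v resolves₁ , x∈p∪q⁺ (inj₂ (x∈⁅x⁆ v))))
    (∣p∪⁅x⁆∣≤∣p∣+1 R₁ v)

  -- Whether v is an R₂-gate need not be decidable, but the bound is.
  ¬¬R₃-bound : ¬ ¬ (∣ R₃ ∣ ≤ ∣ R₂ ∣ + 1)
  ¬¬R₃-bound ¬bound = ¬bound (≤-trans (minimal₃ R₂ (v-resolves₂ , R₂-non-gate)) (m≤m+n ∣ R₂ ∣ 1))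
    where
    R₂-non-gate : ¬ IsGate d R₂ v
    R₂-non-gate (u , u≢v , u-gated) = ¬bound (≤-trans
      (minimal₃ (R₂ ∪ ⁅ u ⁆) ( (Resolving-∪⁅x⁆ d u resolves₂ , x∈p∪q⁺ (inj₁ v∈R₂))
                             , ¬IsGate-∪-witness resolves₂ u≢v u-gated))
      (∣p∪⁅x⁆∣≤∣p∣+1 R₂ u))
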